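{- Let $l$ be a positive integer. For every integer $n\geq l$, the number \[ C_l(n)=\frac{1}{(n+1)^l}\binom{(l+1)n}{n,n,\ldots,n}=\frac{1}{(n+1)^l}\cdot\frac{((l+1)n)!}{(n!)^{l+1}} \] is an integer.
   Context: $\binom{(l+1)n}{n,n,\ldots,n}$ denotes the central multinomial coefficient with $l+1$ lower entries all equal to $n$. The numbers $C_l(n)$ are called multinomial Catalan numbers; $l=1$ gives the usual Catalan numbers. -}

module Defs where

open import Data.Nat using (ℕ; suc; _*_; _^_; _/_; _!)
open import Data.Nat.Properties using (m^n≢0; _!≢0)

-- Central multinomial coefficient ((l+1)n choose n,n,...,n) = ((l+1)n)! / (n!)^(l+1)
-- (l+1 lower entries all equal to n).  The division is exact.
centralMultinomial : ℕ → ℕ → ℕ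
centralMultinomial l n =
  _/_ ((suc l * n) !) ((n !) ^ suc l) ⦃ m^n≢0 (n !) (suc l) ⦃ n !≢0 ⦄ ⦄

module Submission where

open import Data.Nat
open import Data.Nat.Properties
open import Data.Nat.DivMod
open import Data.Nat.Divisibility
open import Data.Nat.Primality using (Prime; prime⇒nonZero; prime⇒nonTrivial; euclidsLemma)
open import Data.Nat.Primality.Factorisation using (factorise)
open import Data.Nat.Induction using (<-wellFounded)
open import Data.Nat.ListAction using (product)
open import Data.Nat.Tactic.RingSolver using (solve-∀)
open import Data.List using ([]; _∷_)
open import Data.List.Relation.Unary.All using (_∷_)
open import Data.Product using (∃; ∃-syntax; _×_; _,_; proj₁; proj₂)
open import Data.Sum using ([_,_])
open import Function using (id)
open import Induction.WellFounded using (Acc; acc)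
open import Relation.Nullary using (yes; no; contradiction)
open import Relation.Binary.PropositionalEquality
  using (_≡_; refl; sym; trans; cong; cong₂; subst; subst₂; module ≡-Reasoning)
open import Algebra.Properties.CommutativeSemigroup +-commutativeSemigroup
  using () renaming (interchange to +-interchange)
open import Algebra.Properties.CommutativeSemigroup *-commutativeSemigroup
  using (x∙yz≈y∙xz) renaming (interchange to *-interchange)

-- For a prime p, Legendre's formula v_p(m!) = ∑_{i ≥ 1} ⌊m/p^i⌋ together with
-- v_p((n+1)!) = v_p(n+1) + v_p(n!) turns v_p((n+1)^l (n!)^(l+1)) into ∑_i (l⌊(n+1)/p^i⌋ + ⌊n/p^i⌋).
-- Let p^K ≤ n+1 < p^(K+1). Only the terms with i ≤ K are nonzero, and each is at most
-- ⌊(l+1)n/p^i⌋ + ⌊l/p^i⌋. Since l p^K ≤ l(n+1) ≤ (l+1)n, the error ⌊l/p^i⌋ is at most the term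
-- ⌊(l+1)n/p^(K+i)⌋ of v_p(((l+1)n)!), which the first K terms do not use.

∑ : ℕ → (ℕ → ℕ) → ℕ
∑ zero    f = 0
∑ (suc B) f = ∑ B f + f (suc B)

∑-cong : ∀ {f g} B → (∀ i → f (suc i) ≡ g (suc i)) → ∑ B f ≡ ∑ B g
∑-cong zero    eq = refl
∑-cong (suc B) eq = cong₂ _+_ (∑-cong B eq) (eq B)

∑-mono-≤ : ∀ {f g} B → (∀ i → f (suc i) ≤ g (suc i)) → ∑ B f ≤ ∑ B g
∑-mono-≤ zero    le = z≤n
∑-mono-≤ (suc B) le = +-mono-≤ (∑-mono-≤ B le) (le B)

∑-zero : ∀ f B → (∀ i → f (suc i) ≡ 0) → ∑ B f ≡ 0
∑-zero f zero    eq = refl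
∑-zero f (suc B) eq = cong₂ _+_ (∑-zero f B eq) (eq B)

∑-suc : ∀ {f g} B → (∀ i → i < B → f (suc i) ≡ suc (g (suc i))) → ∑ B f ≡ B + ∑ B g
∑-suc zero    eq = refl
∑-suc {f} {g} (suc B) eq = begin
  ∑ B f + f (suc B)
    ≡⟨ cong₂ _+_ (∑-suc B λ i i<B → eq i (m<n⇒m<1+n i<B)) (eq B (n<1+n B)) ⟩
  (B + ∑ B g) + suc (g (suc B))     ≡⟨ +-suc (B + ∑ B g) _ ⟩
  suc (B + ∑ B g + g (suc B))       ≡⟨ cong suc (+-assoc B (∑ B g) _) ⟩
  suc B + ∑ (suc B) g               ∎
  where open ≡-Reasoning

∑-distrib-+ : ∀ f g B → ∑ B (λ i → f i + g i) ≡ ∑ B f + ∑ B g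
∑-distrib-+ f g zero    = refl
∑-distrib-+ f g (suc B) = begin
  ∑ B (λ i → f i + g i) + (f (suc B) + g (suc B))
    ≡⟨ cong (_+ (f (suc B) + g (suc B))) (∑-distrib-+ f g B) ⟩
  (∑ B f + ∑ B g) + (f (suc B) + g (suc B))
    ≡⟨ +-interchange (∑ B f) (∑ B g) (f (suc B)) (g (suc B)) ⟩
  ∑ (suc B) f + ∑ (suc B) g                       ∎
  where open ≡-Reasoning

∑-distribˡ-* : ∀ c f B → ∑ B (λ i → c * f i) ≡ c * ∑ B f
∑-distribˡ-* c f zero    = sym (*-zeroʳ c)
∑-distribˡ-* c f (suc B) = trans (cong (_+ c * f (suc B)) (∑-distribˡ-* c f B))
                                 (sym (*-distribˡ-+ c (∑ B f) (f (suc B))))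

∑-split : ∀ f K J → ∑ (K + J) f ≡ ∑ K f + ∑ J (λ i → f (K + i))
∑-split f K zero    = trans (cong (λ b → ∑ b f) (+-identityʳ K)) (sym (+-identityʳ (∑ K f)))
∑-split f K (suc J) = begin
  ∑ (K + suc J) f                                  ≡⟨ cong (λ b → ∑ b f) (+-suc K J) ⟩
  ∑ (K + J) f + f (suc (K + J))                    ≡⟨ cong₂ _+_ (∑-split f K J) (cong f (sym (+-suc K J))) ⟩
  (∑ K f + ∑ J (λ i → f (K + i))) + f (K + suc J)  ≡⟨ +-assoc (∑ K f) _ _ ⟩
  ∑ K f + ∑ (suc J) (λ i → f (K + i))              ∎
  where open ≡-Reasoning

∑-truncate : ∀ f K J → (∀ i → f (K + suc i) ≡ 0) → ∑ (K + J) f ≡ ∑ K f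
∑-truncate f K J eq = begin
  ∑ (K + J) f                       ≡⟨ ∑-split f K J ⟩
  ∑ K f + ∑ J (λ i → f (K + i))     ≡⟨ cong (∑ K f +_) (∑-zero _ J eq) ⟩
  ∑ K f + 0                         ≡⟨ +-identityʳ (∑ K f) ⟩
  ∑ K f                             ∎
  where open ≡-Reasoning

∑-monoˡ-≤ : ∀ f K J → ∑ K f ≤ ∑ (K + J) f
∑-monoˡ-≤ f K J = subst (∑ K f ≤_) (sym (∑-split f K J)) (m≤m+n (∑ K f) _)

m*n≤o⇒m≤o/n : ∀ m n {o} .{{_ : NonZero n}} → m * n ≤ o → m ≤ o / n
m*n≤o⇒m≤o/n m n le = subst (_≤ _) (m*n/n≡m m n) (/-monoˡ-≤ n le)

m<[1+m/n]*n : ∀ m n .{{_ : NonZero n}} → m < suc (m / n) * n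
m<[1+m/n]*n m n = begin-strict
  m                    ≡⟨ m≡m%n+[m/n]*n m n ⟩
  m % n + m / n * n    <⟨ +-monoˡ-< (m / n * n) (m%n<n m n) ⟩
  suc (m / n) * n      ∎
  where open ≤-Reasoning

m*[n/o]≤m*n/o : ∀ m n o .{{_ : NonZero o}} → m * (n / o) ≤ m * n / o
m*[n/o]≤m*n/o m n o = m*n≤o⇒m≤o/n (m * (n / o)) o (begin
  m * (n / o) * o      ≡⟨ *-assoc m (n / o) o ⟩
  m * (n / o * o)      ≤⟨ *-monoʳ-≤ m (m/n*n≤m n o) ⟩
  m * n                ∎)
  where open ≤-Reasoning

/-unique : ∀ {m n k} .{{_ : NonZero n}} → k * n ≤ m → m < suc k * n → m / n ≡ k
/-unique {m} {n} {k} lower upper =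
  ≤-antisym (s≤s⁻¹ (m<n*o⇒m/o<n upper)) (m*n≤o⇒m≤o/n k n lower)

suc-/-∤ : ∀ m n .{{_ : NonZero n}} → n ∤ suc m → suc m / n ≡ m / n
suc-/-∤ m n n∤1+m = /-unique (≤-trans (m/n*n≤m m n) (n≤1+n m))
  (≤∧≢⇒< (m<[1+m/n]*n m n) λ eq → n∤1+m (divides (suc (m / n)) eq))

suc-/-∣ : ∀ m n .{{_ : NonZero n}} → n ∣ suc m → suc m / n ≡ suc (m / n)
suc-/-∣ m n (divides (suc c) eq) = begin
  suc m / n            ≡⟨ /-congˡ eq ⟩
  suc c * n / n        ≡⟨ m*n/n≡m (suc c) n ⟩
  suc c                ≡⟨ cong suc (sym m/n≡c) ⟩
  suc (m / n)          ∎
  where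
  open ≡-Reasoning
  m/n≡c : m / n ≡ c
  m/n≡c = /-unique (s≤s⁻¹ (subst (c * n <_) (sym eq) (m<n+m (c * n) (>-nonZero⁻¹ n))))
                   (subst (m <_) eq (n<1+n m))

-- If q ∤ n+1 this is superadditivity of ⌊_/q⌋; if q ∣ n+1 the left side is (l+1)(n+1)/q − 1,
-- and l + 1 ≤ (⌊l/q⌋ + 1) q.
l*[1+n]/q+n/q≤[1+l]*n/q+l/q : ∀ l n q .{{_ : NonZero q}} →
                              l * (suc n / q) + n / q ≤ suc l * n / q + l / q
l*[1+n]/q+n/q≤[1+l]*n/q+l/q l n q with q ∣? suc n
... | no q∤1+n = begin
  l * (suc n / q) + n / q    ≡⟨ cong (λ x → l * x + n / q) (suc-/-∤ n q q∤1+n) ⟩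
  l * (n / q) + n / q        ≡⟨ +-comm (l * (n / q)) (n / q) ⟩
  suc l * (n / q)            ≤⟨ m*[n/o]≤m*n/o (suc l) n q ⟩
  suc l * n / q              ≤⟨ m≤m+n (suc l * n / q) (l / q) ⟩
  suc l * n / q + l / q      ∎
  where open ≤-Reasoning
... | yes q∣1+n = s≤s⁻¹ (begin
  suc (l * (suc n / q) + n / q)      ≡⟨ cong (λ x → suc (l * x + b)) [1+n]/q≡1+b ⟩
  suc (l * suc b + b)                ≡⟨ cong suc (+-comm (l * suc b) b) ⟩
  suc l * suc b                      ≤⟨ m*n≤o⇒m≤o/n (suc l * suc b) q bound ⟩
  (suc l * n + suc (l / q) * q) / q  ≡⟨ +-distrib-/-∣ʳ (suc l * n) (n∣m*n (suc (l / q))) ⟩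
  suc l * n / q + suc (l / q) * q / q ≡⟨ cong (suc l * n / q +_) (m*n/n≡m (suc (l / q)) q) ⟩
  suc l * n / q + suc (l / q)        ≡⟨ +-suc (suc l * n / q) (l / q) ⟩
  suc (suc l * n / q + l / q)        ∎)
  where
  open ≤-Reasoning
  b = n / q
  [1+n]/q≡1+b : suc n / q ≡ suc b
  [1+n]/q≡1+b = suc-/-∣ n q q∣1+n
  bound : suc l * suc b * q ≤ suc l * n + suc (l / q) * q
  bound = begin
    suc l * suc b * q              ≡⟨ *-assoc (suc l) (suc b) q ⟩
    suc l * (suc b * q)            ≡⟨ cong (λ x → suc l * (x * q)) (sym [1+n]/q≡1+b) ⟩
    suc l * (suc n / q * q)        ≡⟨ cong (suc l *_) (m/n*n≡m q∣1+n) ⟩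
    suc l * suc n                  ≡⟨ *-suc (suc l) n ⟩
    suc l + suc l * n              ≡⟨ +-comm (suc l) (suc l * n) ⟩
    suc l * n + suc l              ≤⟨ +-monoʳ-≤ (suc l * n) (m<[1+m/n]*n l q) ⟩
    suc l * n + suc (l / q) * q    ∎

m/o≤[1+m]*n/d : ∀ m n o d .{{_ : NonZero o}} .{{_ : NonZero d}} → d ≤ o * suc n → m ≤ n →
                m / o ≤ suc m * n / d
m/o≤[1+m]*n/d m n o d d≤o*[1+n] m≤n = begin
  m / o                       ≡⟨ sym (m*n/o*n≡m/o m (suc n) o) ⟩
  m * suc n / (o * suc n)     ≤⟨ /-monoˡ-≤ (o * suc n) m*[1+n]≤[1+m]*n ⟩
  suc m * n / (o * suc n)     ≤⟨ /-monoʳ-≤ (suc m * n) d≤o*[1+n] ⟩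
  suc m * n / d               ∎
  where
  open ≤-Reasoning
  instance
    o*[1+n]≢0 : NonZero (o * suc n)
    o*[1+n]≢0 = m*n≢0 o (suc n)
  m*[1+n]≤[1+m]*n : m * suc n ≤ suc m * n
  m*[1+n]≤[1+m]*n = begin
    m * suc n      ≡⟨ *-suc m n ⟩
    m + m * n      ≤⟨ +-monoˡ-≤ (m * n) m≤n ⟩
    suc m * n      ∎

^-monoʳ-∣ : ∀ m {k n} → k ≤ n → m ^ k ∣ m ^ n
^-monoʳ-∣ m {k} {n} k≤n = divides (m ^ (n ∸ k)) (begin
  m ^ n                  ≡⟨ cong (m ^_) (sym (m+[n∸m]≡n k≤n)) ⟩
  m ^ (k + (n ∸ k))      ≡⟨ ^-distribˡ-+-* m k (n ∸ k) ⟩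
  m ^ k * m ^ (n ∸ k)    ≡⟨ *-comm (m ^ k) (m ^ (n ∸ k)) ⟩
  m ^ (n ∸ k) * m ^ k    ∎)
  where open ≡-Reasoning

n<m^n : ∀ {m} → 1 < m → ∀ n → n < m ^ n
n<m^n 1<m zero    = z<s
n<m^n 1<m (suc n) = ≤-<-trans (n<m^n 1<m n) (^-monoʳ-< _ 1<m (n<1+n n))

∃-bracketing-power : ∀ {p} → 1 < p → ∀ a → 0 < a → ∃[ K ] p ^ K ≤ a × a < p ^ suc K
∃-bracketing-power {p} 1<p a 0<a = search a (n<m^n 1<p a)
  where
  search : ∀ t → a < p ^ t → ∃[ K ] p ^ K ≤ a × a < p ^ suc K
  search zero    a<1 = contradiction 0<a (<⇒≱ a<1)
  search (suc t) a<p^[1+t] with p ^ t ≤? a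
  ... | yes p^t≤a = t , p^t≤a , a<p^[1+t]
  ... | no  p^t≰a = search t (≰⇒> p^t≰a)

prime⇒>1 : ∀ {p} → Prime p → p > 1
prime⇒>1 {p} p-prime = nonTrivial⇒n>1 p {{prime⇒nonTrivial p-prime}}

record Multiplicity (p x e : ℕ) : Set where
  constructor multiplicity
  field
    cofactor         : ℕ
    x≡p^e*cofactor   : x ≡ p ^ e * cofactor
    p∤cofactor       : p ∤ cofactor

open Multiplicity

∃-multiplicity : ∀ {p} → 1 < p → ∀ x .{{_ : NonZero x}} → ∃ (Multiplicity p x)
∃-multiplicity {p} 1<p x = go x (<-wellFounded x)
  where
  go : ∀ x .{{_ : NonZero x}} → Acc _<_ x → ∃ (Multiplicity p x)
  go x (acc rec) with p ∣? x
  ... | no  p∤x = 0 , multiplicity x (sym (+-identityʳ x)) p∤x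
  ... | yes (divides q refl) with go q {{q≢0}} (rec (m<m*n q p {{q≢0}} 1<p))
    where q≢0 = m*n≢0⇒m≢0 q
  ... | e , multiplicity r q≡p^e*r p∤r = suc e , multiplicity r (begin
    q * p               ≡⟨ cong (_* p) q≡p^e*r ⟩
    p ^ e * r * p       ≡⟨ *-comm (p ^ e * r) p ⟩
    p * (p ^ e * r)     ≡⟨ *-assoc p (p ^ e) r ⟨
    p ^ suc e * r       ∎) p∤r
    where open ≡-Reasoning

^multiplicity∣ : ∀ {p x e} → Multiplicity p x e → p ^ e ∣ x
^multiplicity∣ {p} {e = e} (multiplicity r x≡p^e*r _) = divides r (trans x≡p^e*r (*-comm (p ^ e) r))

^∣⇒≤multiplicity : ∀ {p x e} k .{{_ : NonZero p}} → Multiplicity p x e → p ^ k ∣ x → k ≤ e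
^∣⇒≤multiplicity {p} {x} {e} k (multiplicity r x≡p^e*r p∤r) p^k∣x = ≮⇒≥ λ e<k →
  p∤r (*-cancelˡ-∣ (p ^ e) {{m^n≢0 p e}} (begin
    p ^ e * p    ≡⟨ *-comm (p ^ e) p ⟩
    p ^ suc e    ∣⟨ ^-monoʳ-∣ p e<k ⟩
    p ^ k        ∣⟨ p^k∣x ⟩
    x            ≡⟨ x≡p^e*r ⟩
    p ^ e * r    ∎))
  where open ∣-Reasoning

multiplicity-1 : ∀ {p} → 1 < p → Multiplicity p 1 0
multiplicity-1 1<p = multiplicity 1 refl λ p∣1 → <⇒≢ 1<p (sym (∣1⇒≡1 p∣1))

multiplicity-* : ∀ {p x y a b} → Prime p → Multiplicity p x a → Multiplicity p y b →
                 Multiplicity p (x * y) (a + b)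
multiplicity-* {p} {x} {y} {a} {b} p-prime
  (multiplicity r x≡p^a*r p∤r) (multiplicity s y≡p^b*s p∤s) = multiplicity (r * s) (begin
    x * y                       ≡⟨ cong₂ _*_ x≡p^a*r y≡p^b*s ⟩
    p ^ a * r * (p ^ b * s)     ≡⟨ *-interchange (p ^ a) r (p ^ b) s ⟩
    p ^ a * p ^ b * (r * s)     ≡⟨ cong (_* (r * s)) (^-distribˡ-+-* p a b) ⟨
    p ^ (a + b) * (r * s)       ∎)
  λ p∣r*s → [ p∤r , p∤s ] (euclidsLemma r s p-prime p∣r*s)
  where open ≡-Reasoning

multiplicity-^ : ∀ {p x a} → Prime p → Multiplicity p x a → ∀ j → Multiplicity p (x ^ j) (j * a)
multiplicity-^ p-prime v zero    = multiplicity-1 (prime⇒>1 p-prime)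
multiplicity-^ p-prime v (suc j) = multiplicity-* p-prime v (multiplicity-^ p-prime v j)

cofactor≢0 : ∀ {p x e} .{{_ : NonZero x}} → (v : Multiplicity p x e) → NonZero (cofactor v)
cofactor≢0 {p} {x} {e} (multiplicity r x≡p^e*r _) = ≢-nonZero λ r≡0 →
  ≢-nonZero⁻¹ x (trans x≡p^e*r (trans (cong (p ^ e *_) r≡0) (*-zeroʳ (p ^ e))))

cofactor<x : ∀ {p x e} .{{_ : NonZero x}} → 1 < p → p ∣ x → (v : Multiplicity p x e) → cofactor v < x
cofactor<x {p} {x} {zero}  1<p p∣x (multiplicity r x≡1*r p∤r) =
  contradiction (subst (p ∣_) (trans x≡1*r (*-identityˡ r)) p∣x) p∤r
cofactor<x {p} {x} {suc e} 1<p p∣x v@(multiplicity r x≡p^[1+e]*r _) = begin-strict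
  r                 <⟨ m<m*n r (p ^ suc e) {{cofactor≢0 v}} (^-monoʳ-< p 1<p (s≤s (z≤n {e}))) ⟩
  r * p ^ suc e     ≡⟨ *-comm r (p ^ suc e) ⟩
  p ^ suc e * r     ≡⟨ x≡p^[1+e]*r ⟨
  x                 ∎
  where open ≤-Reasoning

∃-prime-divisor : ∀ {a} → 1 < a → ∃[ p ] Prime p × p ∣ a
∃-prime-divisor {suc a} 1<a with factorise (suc a)
... | record { factors = [] ; isFactorisation = a≡1 } = contradiction a≡1 (>⇒≢ 1<a)
... | record { factors = p ∷ ps ; isFactorisation = a≡p*Πps ; factorsPrime = p-prime ∷ _ } =
  p , p-prime , divides (product ps) (trans a≡p*Πps (*-comm p (product ps)))

prime-power-*-∣ : ∀ {p r b} e → Prime p → p ∤ r → p ^ e ∣ b → r ∣ b → p ^ e * r ∣ b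
prime-power-*-∣ {p} {r} {b} zero    _       _   _   r∣b = subst (_∣ b) (sym (*-identityˡ r)) r∣b
prime-power-*-∣ {p} {r} {b} (suc e) p-prime p∤r p^[1+e]∣b r∣b
  with prime-power-*-∣ e p-prime p∤r (∣-trans (^-monoʳ-∣ p (n≤1+n e)) p^[1+e]∣b) r∣b
... | divides c b≡c*[p^e*r] = begin
  p ^ suc e * r          ≡⟨ *-assoc p (p ^ e) r ⟩
  p * (p ^ e * r)        ∣⟨ *-monoˡ-∣ (p ^ e * r) p∣c ⟩
  c * (p ^ e * r)        ≡⟨ b≡c*[p^e*r] ⟨
  b                      ∎
  where
  open ∣-Reasoning
  p∣c*r : p ∣ c * r
  p∣c*r = *-cancelˡ-∣ (p ^ e) {{m^n≢0 p e {{prime⇒nonZero p-prime}}}}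
    (subst₂ _∣_ (*-comm p (p ^ e)) (trans b≡c*[p^e*r] (x∙yz≈y∙xz c (p ^ e) r)) p^[1+e]∣b)
  p∣c : p ∣ c
  p∣c = [ id , (λ p∣r → contradiction p∣r p∤r) ] (euclidsLemma c r p-prime p∣c*r)

prime-powers-∣⇒∣ : ∀ {a b} .{{_ : NonZero a}} →
                   (∀ {p} k → Prime p → p ^ k ∣ a → p ^ k ∣ b) → a ∣ b
prime-powers-∣⇒∣ {a} {b} = go a (<-wellFounded a)
  where
  go : ∀ a .{{_ : NonZero a}} → Acc _<_ a →
       (∀ {p} k → Prime p → p ^ k ∣ a → p ^ k ∣ b) → a ∣ b
  go 1                 _         _ = 1∣ b
  go a@(suc (suc _)) (acc rec) h with ∃-prime-divisor {a} (s<s z<s)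
  ... | p , p-prime , p∣a with ∃-multiplicity (prime⇒>1 p-prime) a
  ... | e , v@(multiplicity r a≡p^e*r p∤r) =
    subst (_∣ b) (sym a≡p^e*r) (prime-power-*-∣ e p-prime p∤r (h e p-prime (^multiplicity∣ v)) r∣b)
    where
    r∣b : r ∣ b
    r∣b = go r {{cofactor≢0 v}} (rec (cofactor<x (prime⇒>1 p-prime) p∣a v))
            λ k q-prime q^k∣r → h k q-prime (∣-trans q^k∣r (divides (p ^ e) a≡p^e*r))

module _ (p : ℕ) .{{_ : NonZero p}} where

  -- Instance search cannot see that p ^ i is nonzero for a variable exponent i.
  infixl 7 _/p^_
  _/p^_ : ℕ → ℕ → ℕ
  m /p^ i = _/_ m (p ^ i) {{m^n≢0 p i}}

  legendreSum : ℕ → ℕ → ℕ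
  legendreSum B m = ∑ B (m /p^_)

  legendreSum-zero : ∀ B → legendreSum B 0 ≡ 0
  legendreSum-zero B = ∑-zero (0 /p^_) B λ i → 0/n≡0 (p ^ suc i) {{m^n≢0 p (suc i)}}

  legendreSum-suc : ∀ B {m e} → suc m < p ^ B → Multiplicity p (suc m) e →
                    legendreSum B (suc m) ≡ e + legendreSum B m
  legendreSum-suc B {m} {e} 1+m<p^B v = begin
    ∑ B f                                        ≡⟨ cong (λ b → ∑ b f) e+J≡B ⟨
    ∑ (e + J) f                                  ≡⟨ ∑-split f e J ⟩
    ∑ e f + ∑ J (λ i → f (e + i))                ≡⟨ cong₂ _+_ (∑-suc e below) (∑-cong J above) ⟩
    (e + ∑ e g) + ∑ J (λ i → g (e + i))          ≡⟨ +-assoc e _ _ ⟩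
    e + (∑ e g + ∑ J (λ i → g (e + i)))          ≡⟨ cong (e +_) (∑-split g e J) ⟨
    e + ∑ (e + J) g                              ≡⟨ cong (λ b → e + ∑ b g) e+J≡B ⟩
    e + ∑ B g                                    ∎
    where
    open ≡-Reasoning
    f g : ℕ → ℕ
    f = suc m /p^_
    g = m /p^_
    e<B : e < B
    e<B = ≰⇒> λ B≤e → <⇒≱ 1+m<p^B (≤-trans (^-monoʳ-≤ p B≤e) (∣⇒≤ (^multiplicity∣ v)))
    J = B ∸ e
    e+J≡B : e + J ≡ B
    e+J≡B = m+[n∸m]≡n (<⇒≤ e<B)
    below : ∀ i → i < e → f (suc i) ≡ suc (g (suc i))
    below i i<e = suc-/-∣ m (p ^ suc i) {{m^n≢0 p (suc i)}}
                    (∣-trans (^-monoʳ-∣ p i<e) (^multiplicity∣ v))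
    above : ∀ i → f (e + suc i) ≡ g (e + suc i)
    above i = suc-/-∤ m (p ^ (e + suc i)) {{m^n≢0 p (e + suc i)}}
                λ p^[e+1+i]∣1+m → m+1+n≰m e (^∣⇒≤multiplicity (e + suc i) v p^[e+1+i]∣1+m)

  legendreSum-inequality : ∀ {l n} K J → p ^ K ≤ suc n → suc n < p ^ suc K → l ≤ n →
    l * legendreSum (K + (K + J)) (suc n) + legendreSum (K + (K + J)) n
      ≤ legendreSum (K + (K + J)) (suc l * n)
  legendreSum-inequality {l} {n} K J p^K≤1+n 1+n<p^[1+K] l≤n = begin
    l * ∑ B (suc n /p^_) + ∑ B (n /p^_)
      ≡⟨ cong (_+ ∑ B (n /p^_)) (∑-distribˡ-* l (suc n /p^_) B) ⟨
    ∑ B (λ i → l * (suc n /p^ i)) + ∑ B (n /p^_)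
      ≡⟨ ∑-distrib-+ (λ i → l * (suc n /p^ i)) (n /p^_) B ⟨
    ∑ B lower                                    ≡⟨ ∑-truncate lower K (K + J) lower-vanishes ⟩
    ∑ K lower                                    ≤⟨ ∑-mono-≤ K termwise ⟩
    ∑ K (λ i → upper i + l /p^ i)                ≡⟨ ∑-distrib-+ upper (l /p^_) K ⟩
    ∑ K upper + ∑ K (l /p^_)                     ≤⟨ +-monoʳ-≤ (∑ K upper) (∑-mono-≤ K absorbed) ⟩
    ∑ K upper + ∑ K (λ i → upper (K + i))        ≡⟨ ∑-split upper K K ⟨
    ∑ (K + K) upper                              ≤⟨ ∑-monoˡ-≤ upper (K + K) J ⟩
    ∑ (K + K + J) upper                          ≡⟨ cong (λ b → ∑ b upper) (+-assoc K K J) ⟩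
    ∑ B upper                                    ∎
    where
    open ≤-Reasoning
    B = K + (K + J)
    lower upper : ℕ → ℕ
    lower i = l * (suc n /p^ i) + n /p^ i
    upper i = suc l * n /p^ i
    termwise : ∀ i → lower (suc i) ≤ upper (suc i) + l /p^ suc i
    termwise i = l*[1+n]/q+n/q≤[1+l]*n/q+l/q l n (p ^ suc i) {{m^n≢0 p (suc i)}}
    lower-vanishes : ∀ i → lower (K + suc i) ≡ 0
    lower-vanishes i = begin-equality
      l * (suc n /p^ (K + suc i)) + n /p^ (K + suc i)
        ≡⟨ cong₂ (λ x y → l * x + y) (m<n⇒m/n≡0 1+n<q) (m<n⇒m/n≡0 (<-trans (n<1+n n) 1+n<q)) ⟩
      l * 0 + 0                                  ≡⟨ cong (_+ 0) (*-zeroʳ l) ⟩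
      0                                          ∎
      where
      instance
        q≢0 : NonZero (p ^ (K + suc i))
        q≢0 = m^n≢0 p (K + suc i)
      1+n<q : suc n < p ^ (K + suc i)
      1+n<q = <-≤-trans 1+n<p^[1+K] (^-monoʳ-≤ p (subst (suc K ≤_) (sym (+-suc K i)) (s≤s (m≤m+n K i))))
    absorbed : ∀ i → l /p^ suc i ≤ upper (K + suc i)
    absorbed i = m/o≤[1+m]*n/d l n (p ^ suc i) (p ^ (K + suc i)) {{m^n≢0 p (suc i)}} {{m^n≢0 p (K + suc i)}}
      (begin
        p ^ (K + suc i)         ≡⟨ cong (p ^_) (+-comm K (suc i)) ⟩
        p ^ (suc i + K)         ≡⟨ ^-distribˡ-+-* p (suc i) K ⟩
        p ^ suc i * p ^ K       ≤⟨ *-monoʳ-≤ (p ^ suc i) p^K≤1+n ⟩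
        p ^ suc i * suc n       ∎)
      l≤n


module _ {p} (p-prime : Prime p) where

  private
    instance
      p≢0 : NonZero p
      p≢0 = prime⇒nonZero p-prime
    1<p : 1 < p
    1<p = prime⇒>1 p-prime

  legendre : ∀ B m → m < p ^ B → Multiplicity p (m !) (legendreSum p B m)
  legendre B zero    _       = subst (Multiplicity p 1) (sym (legendreSum-zero p B)) (multiplicity-1 1<p)
  legendre B (suc m) 1+m<p^B with ∃-multiplicity 1<p (suc m)
  ... | e , v = subst (Multiplicity p (suc m !)) (sym (legendreSum-suc p B 1+m<p^B v))
                  (multiplicity-* p-prime v (legendre B m (<-trans (n<1+n m) 1+m<p^B)))

  prime-power-∣-factorial : ∀ {l n} k → l ≤ n →
                            p ^ k ∣ suc n ^ l * (n !) ^ suc l → p ^ k ∣ (suc l * n) !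
  prime-power-∣-factorial {l} {n} k l≤n p^k∣denominator
    with ∃-bracketing-power 1<p (suc n) z<s | ∃-multiplicity 1<p (suc n)
  ... | K , p^K≤1+n , 1+n<p^[1+K] | e , v[1+n] = ∣-trans (^-monoʳ-∣ p k≤) (^multiplicity∣ v[numerator])
    where
    -- B is large enough for Legendre's formula at n, n + 1 and (l + 1) n, and leaves room for 2K terms.
    J = suc (suc l * n)
    B = K + (K + J)
    <p^B : ∀ {m} → m ≤ J → m < p ^ B
    <p^B {m} m≤J = begin-strict
      m         <⟨ n<m^n 1<p m ⟩
      p ^ m     ≤⟨ ^-monoʳ-≤ p (≤-trans m≤J (≤-trans (m≤n+m J K) (m≤n+m (K + J) K))) ⟩
      p ^ B     ∎
      where open ≤-Reasoning
    1+n<p^B : suc n < p ^ B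
    1+n<p^B = <p^B (s≤s (m≤m+n n (l * n)))
    S : ℕ → ℕ
    S = legendreSum p B
    v[numerator] = legendre B (suc l * n) (<p^B (n≤1+n (suc l * n)))
    v[denominator] = multiplicity-* p-prime (multiplicity-^ p-prime v[1+n] l)
                       (multiplicity-^ p-prime (legendre B n (<-trans (n<1+n n) 1+n<p^B)) (suc l))
    rearrange : ∀ l e x → l * e + suc l * x ≡ l * (e + x) + x
    rearrange = solve-∀
    k≤ : k ≤ S (suc l * n)
    k≤ = begin
      k                          ≤⟨ ^∣⇒≤multiplicity k v[denominator] p^k∣denominator ⟩
      l * e + suc l * S n        ≡⟨ rearrange l e (S n) ⟩
      l * (e + S n) + S n        ≡⟨ cong (λ x → l * x + S n) (legendreSum-suc p B 1+n<p^B v[1+n]) ⟨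
      l * S (suc n) + S n        ≤⟨ legendreSum-inequality p K J p^K≤1+n 1+n<p^[1+K] l≤n ⟩
      S (suc l * n)              ∎
      where open ≤-Reasoning

theorem1 : (l n : ℕ) → 1 ≤ l → l ≤ n →
    (suc n ^ l) * ((n !) ^ suc l) ∣ (suc l * n) !
theorem1 l n _ l≤n =
  prime-powers-∣⇒∣ {{denominator≢0}} λ k p-prime → prime-power-∣-factorial p-prime k l≤n
  where
  instance
    n!≢0 : NonZero (n !)
    n!≢0 = n !≢0
  denominator≢0 : NonZero (suc n ^ l * (n !) ^ suc l)
  denominator≢0 = m*n≢0 (suc n ^ l) ((n !) ^ suc l) {{m^n≢0 (suc n) l}} {{m^n≢0 (n !) (suc l)}}
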